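{- The semigroup $S_n=M_n\setminus\{\mathbf{1}\}$ has exactly $\frac{n(n+1)}{2}$ idempotents and exactly $\frac{n^3}{3}-\frac{n}{3}+1$ nilpotents.
   Context: Fix an integer $n\ge 2$. For integers $d,k,m$ with $1-\min(0,d)\le k\le m\le n-\max(0,d)$, let $\langle d,k,m\rangle$ denote the $n\times n$ matrix with entries $x_{ij}$ ($i,j\in\{1,\dots,n\}$) equal to $1$ if $k\le i\le m$ and $j-i=d$, and $0$ otherwise. Let $\mathbf{0}$ be the $n\times n$ zero matrix, $M_n=\{\mathbf{0}\}\cup\{\langle d,k,m\rangle: d\in\mathbb{Z},\ k,m\in\mathbb{N},\ 1-\min(0,d)\le k\le m\le n-\max(0,d)\}$ (a monoid under matrix multiplication with identity $\mathbf{1}=\langle 0,1,n\rangle$), and $S_n=M_n\setminus\{\mathbf{1}\}$. An element $x$ is idempotent if $x^2=x$ and nilpotent if $x^j=\mathbf{0}$ for some $j\in\mathbb{N}$ (so $\mathbf{0}$ is both). -}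

module Defs where

open import Data.Nat as ℕ using (ℕ; zero; suc)
open import Data.Integer as ℤ using (ℤ; +_)
open import Data.Fin using (Fin; toℕ)
open import Data.List using (List; map; length; allFin)
open import Data.Nat.ListAction using (sum)
open import Data.List.Relation.Unary.All using (All)
open import Data.List.Relation.Unary.Any using (Any)
open import Data.List.Relation.Unary.AllPairs using (AllPairs)
open import Data.Bool using (if_then_else_; _∧_)
open import Data.Product using (Σ; ∃; _×_)
open import Data.Sum using (_⊎_)
open import Relation.Nullary using (¬_)
open import Relation.Nullary.Decidable using (⌊_⌋)
open import Relation.Binary.PropositionalEquality using (_≡_)

-- n × n matrices with natural-number entries; index i : Fin n stands for row/column (toℕ i + 1).
Mat : ℕ → Set
Mat n = Fin n → Fin n → ℕ

_≈_ : ∀ {n} → Mat n → Mat n → Set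
A ≈ B = ∀ i j → A i j ≡ B i j

_·_ : ∀ {n} → Mat n → Mat n → Mat n
(A · B) i j = sum (map (λ l → A i l ℕ.* B l j) (allFin _))

𝟎 : ∀ {n} → Mat n
𝟎 i j = 0

𝟏 : ∀ {n} → Mat n
𝟏 = λ i j → if ⌊ toℕ i ℕ.≟ toℕ j ⌋ then 1 else 0

pow : ∀ {n} → Mat n → ℕ → Mat n
pow A zero = 𝟏
pow A (suc j) = A · pow A j

idx : ∀ {n} → Fin n → ℕ
idx i = suc (toℕ i)

⟨_,_,_⟩ : ∀ {n} → ℤ → ℕ → ℕ → Mat n
⟨ d , k , m ⟩ i j =
  if ⌊ k ℕ.≤? idx i ⌋ ∧ ⌊ idx i ℕ.≤? m ⌋ ∧ ⌊ + idx j ℤ.≟ (+ idx i) ℤ.+ d ⌋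
  then 1 else 0

Admissible : ℕ → ℤ → ℕ → ℕ → Set
Admissible n d k m =
  (+ 1 ℤ.- (+ 0 ℤ.⊓ d)) ℤ.≤ + k × k ℕ.≤ m × + m ℤ.≤ (+ n ℤ.- (+ 0 ℤ.⊔ d))

InM : ∀ n → Mat n → Set
InM n A = A ≈ 𝟎 ⊎ Σ ℤ λ d → Σ ℕ λ k → Σ ℕ λ m → Admissible n d k m × A ≈ ⟨ d , k , m ⟩

InS : ∀ n → Mat n → Set
InS n A = InM n A × ¬ (A ≈ 𝟏)

Idempotent : ∀ {n} → Mat n → Set
Idempotent A = (A · A) ≈ A

Nilpotent : ∀ {n} → Mat n → Set
Nilpotent A = ∃ λ j → pow A (suc j) ≈ 𝟎

HasExactly : ∀ {n} → (Mat n → Set) → ℕ → Set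
HasExactly {n} P N = Σ (List (Mat n)) λ L →
  length L ≡ N × All P L × AllPairs (λ A B → ¬ (A ≈ B)) L × (∀ A → P A → Any (A ≈_) L)

-- Every ⟨ d , k , m ⟩ is supported on the diagonal j - i = d, and a product of matrices supported
-- on the diagonals d and e is supported on d + e.  So x · x = x forces d = 0, and conversely every
-- ⟨ 0 , k , m ⟩ is idempotent: the idempotents of S_n are 𝟎 and the ⟨ 0 , k , m ⟩ with
-- [k, m] ≠ [1, n], i.e. 1 + (n(n+1)/2 - 1) of them.  The powers of ⟨ d , k , m ⟩ live on the
-- diagonals j·d, which leave the matrix once d ≠ 0, while ⟨ 0 , k , m ⟩ is a nonzero idempotent;
-- so the nilpotents are 𝟎 and the bands with d ≠ 0.  For |d| = n - q the row interval [k, m]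
-- ranges over the q(q+1)/2 subintervals of a window of q rows, once for each sign of d, and
-- 2 Σ_{q<n} q(q+1)/2 = (n³ - n)/3.

module Submission where

open import Algebra.Bundles using (AbelianGroup)
open import Data.Bool using (if_then_else_; _∧_)
open import Data.Empty using (⊥-elim)
open import Data.Fin using (Fin; toℕ; fromℕ<) renaming (zero to fzero; suc to fsuc)
import Data.Fin.Properties as FinP
open import Data.Integer as ℤ using (ℤ; +_; -[1+_]; ∣_∣)
import Data.Integer.Properties as ℤP
open import Data.List using (List; []; _∷_; _++_; map; length; tabulate; allFin; applyUpTo)
open import Data.List.Properties using (map-tabulate; map-cong; length-map; length-++; length-applyUpTo)
open import Data.List.Membership.Propositional using (_∈_; lose)
open import Data.List.Membership.Propositional.Properties
  using (∈-map⁺; ∈-map⁻; ∈-++⁺ˡ; ∈-++⁺ʳ; ∈-++⁻; ∈-applyUpTo⁺; ∈-applyUpTo⁻)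
open import Data.List.Relation.Unary.All as All using (All; []; _∷_)
import Data.List.Relation.Unary.All.Properties as AllP
open import Data.List.Relation.Unary.Any as Any using (Any; here; there)
import Data.List.Relation.Unary.Any.Properties as AnyP
open import Data.List.Relation.Unary.AllPairs using (AllPairs; []; _∷_)
open import Data.List.Relation.Unary.Unique.Propositional using (Unique)
import Data.List.Relation.Unary.Unique.Propositional.Properties as UniqueP
open import Data.Nat as ℕ using (ℕ; zero; suc; _+_; _*_; _∸_; _^_; _≤_; _<_; z≤n; s≤s; s≤s⁻¹; _≟_; _≤?_)
open import Data.Nat.DivMod using (_/_; m*n/n≡m)
open import Data.Nat.ListAction using (sum)
open import Data.Nat.Properties
open import Data.Nat.Tactic.RingSolver using (solve-∀)
open import Data.Product using (Σ; ∃; ∃₂; _×_; _,_; proj₁; proj₂)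
open import Data.Sum using (_⊎_; inj₁; inj₂; [_,_]′)
open import Function using (_∘_; _⇔_; mk⇔; Equivalence)
open import Relation.Nullary using (¬_; Dec; does; yes; no)
open import Relation.Nullary.Decidable using (_×-dec_; map′; dec-true; dec-false; decidable-stable; isYes≗does)
open import Relation.Binary.PropositionalEquality

open import Algebra.Properties.Group (AbelianGroup.group ℤP.+-0-abelianGroup)
  using (∙-cancelˡ; identityʳ-unique; y≈x\\z; //-rightDividesˡ; //-rightDividesʳ)
open import Defs

sum-tabulate-zero : ∀ {n} (f : Fin n → ℕ) → (∀ l → f l ≡ 0) → sum (tabulate f) ≡ 0
sum-tabulate-zero {zero}  f f≡0 = refl
sum-tabulate-zero {suc n} f f≡0 =
  cong₂ _+_ (f≡0 fzero) (sum-tabulate-zero (f ∘ fsuc) (f≡0 ∘ fsuc))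

sum-tabulate-single : ∀ {n} (f : Fin n → ℕ) p → (∀ l → l ≢ p → f l ≡ 0) → sum (tabulate f) ≡ f p
sum-tabulate-single f fzero off = begin
  f fzero + sum (tabulate (f ∘ fsuc))
    ≡⟨ cong (_+_ (f fzero)) (sum-tabulate-zero _ (λ l → off (fsuc l) λ ())) ⟩
  f fzero + 0
    ≡⟨ +-identityʳ _ ⟩
  f fzero ∎
  where open ≡-Reasoning
sum-tabulate-single f (fsuc p) off =
  cong₂ _+_ (off fzero λ ())
    (sum-tabulate-single (f ∘ fsuc) p (λ l l≢p → off (fsuc l) (l≢p ∘ FinP.suc-injective)))

sum-map-≢0⇒Any : ∀ {A : Set} (f : A → ℕ) xs → sum (map f xs) ≢ 0 → Any (λ x → f x ≢ 0) xs
sum-map-≢0⇒Any f []       s≢0 = ⊥-elim (s≢0 refl)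
sum-map-≢0⇒Any f (x ∷ xs) s≢0 with f x ≟ 0
... | yes fx≡0 = there (sum-map-≢0⇒Any f xs (λ s≡0 → s≢0 (cong₂ _+_ fx≡0 s≡0)))
... | no  fx≢0 = here fx≢0

module _ {n : ℕ} where

  ≈-sym : {A B : Mat n} → A ≈ B → B ≈ A
  ≈-sym A≈B i j = sym (A≈B i j)

  ≈-trans : {A B C : Mat n} → A ≈ B → B ≈ C → A ≈ C
  ≈-trans A≈B B≈C i j = trans (A≈B i j) (B≈C i j)

  ·-cong : {A A′ B B′ : Mat n} → A ≈ A′ → B ≈ B′ → (A · B) ≈ (A′ · B′)
  ·-cong A≈A′ B≈B′ i j = cong sum (map-cong (λ l → cong₂ _*_ (A≈A′ i l) (B≈B′ l j)) (allFin n))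

  pow-cong : {A B : Mat n} → A ≈ B → ∀ j → pow A j ≈ pow B j
  pow-cong A≈B zero    i l = refl
  pow-cong A≈B (suc j) = ·-cong A≈B (pow-cong A≈B j)

  idempotent-resp-≈ : {A B : Mat n} → A ≈ B → Idempotent A → Idempotent B
  idempotent-resp-≈ A≈B idem i j = trans (sym (·-cong A≈B A≈B i j)) (trans (idem i j) (A≈B i j))

  nilpotent-resp-≈ : {A B : Mat n} → A ≈ B → Nilpotent A → Nilpotent B
  nilpotent-resp-≈ A≈B (j , Aʲ≈𝟎) = j , λ i l → trans (sym (pow-cong A≈B (suc j) i l)) (Aʲ≈𝟎 i l)

  ·-support : (A B : Mat n) (i j : Fin n) → (A · B) i j ≢ 0 → ∃ λ l → A i l ≢ 0 × B l j ≢ 0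
  ·-support A B i j AB≢0 with Any.satisfied (sum-map-≢0⇒Any (λ l → A i l * B l j) (allFin n) AB≢0)
  ... | l , AB≢0 =
    l , (AB≢0 ∘ cong (_* B l j)) , (λ B≡0 → AB≢0 (trans (cong (A i l *_) B≡0) (*-zeroʳ (A i l))))

  ·-unitRow : (A B : Mat n) (i p j : Fin n) → (∀ l → l ≢ p → A i l ≡ 0) → A i p ≡ 1 → (A · B) i j ≡ B p j
  ·-unitRow A B i p j off Aip≡1 = begin
    sum (map (λ l → A i l * B l j) (allFin n))
      ≡⟨ cong sum (map-tabulate (λ l → l) (λ l → A i l * B l j)) ⟩
    sum (tabulate (λ l → A i l * B l j))
      ≡⟨ sum-tabulate-single _ p (λ l l≢p → cong (_* B l j) (off l l≢p)) ⟩
    A i p * B p j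
      ≡⟨ cong (_* B p j) Aip≡1 ⟩
    1 * B p j
      ≡⟨ *-identityˡ _ ⟩
    B p j ∎
    where open ≡-Reasoning

  ·-zeroRow : (A B : Mat n) (i j : Fin n) → (∀ l → A i l ≡ 0) → (A · B) i j ≡ 0
  ·-zeroRow A B i j Ai≡0 = trans (cong sum (map-tabulate (λ l → l) (λ l → A i l * B l j)))
    (sum-tabulate-zero _ (λ l → cong (_* B l j) (Ai≡0 l)))

  idx-injective : {i j : Fin n} → idx i ≡ idx j → i ≡ j
  idx-injective = FinP.toℕ-injective ∘ suc-injective

  idx≤n : (i : Fin n) → idx i ≤ n
  idx≤n = FinP.toℕ<n

  fromIdx : ∀ {r} → 1 ≤ r → r ≤ n → Σ (Fin n) λ i → idx i ≡ r
  fromIdx {suc r} _ r<n = fromℕ< r<n , cong suc (FinP.toℕ-fromℕ< r<n)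

  shift₀⇔≡ : {i j : Fin n} → (+ idx j ≡ + idx i ℤ.+ + 0) ⇔ (j ≡ i)
  shift₀⇔≡ = mk⇔ (λ e → idx-injective (ℤP.+-injective (trans e (ℤP.+-identityʳ _))))
                 (λ { refl → sym (ℤP.+-identityʳ _) })

  -- Matrices supported on one diagonal

  OnDiagonal : ℤ → Mat n → Set
  OnDiagonal d A = ∀ i j → A i j ≢ 0 → + idx j ≡ + idx i ℤ.+ d

  𝟏-onDiagonal : OnDiagonal (+ 0) 𝟏
  𝟏-onDiagonal i j 𝟏ij≢0 with toℕ i ℕ.≟ toℕ j
  ... | yes i≡j = Equivalence.from shift₀⇔≡ (FinP.toℕ-injective (sym i≡j))
  ... | no  _   = ⊥-elim (𝟏ij≢0 refl)

  ·-onDiagonal : ∀ {d e} {A B : Mat n} → OnDiagonal d A → OnDiagonal e B → OnDiagonal (d ℤ.+ e) (A · B)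
  ·-onDiagonal {d} {e} {A} {B} diagA diagB i j AB≢0 with ·-support A B i j AB≢0
  ... | l , Ail≢0 , Blj≢0 = begin
    + idx j              ≡⟨ diagB l j Blj≢0 ⟩
    + idx l ℤ.+ e        ≡⟨ cong (ℤ._+ e) (diagA i l Ail≢0) ⟩
    + idx i ℤ.+ d ℤ.+ e  ≡⟨ ℤP.+-assoc (+ idx i) d e ⟩
    + idx i ℤ.+ (d ℤ.+ e) ∎
    where open ≡-Reasoning

  pow-onDiagonal : ∀ {d} {A : Mat n} → OnDiagonal d A → ∀ j → OnDiagonal (+ j ℤ.* d) (pow A j)
  pow-onDiagonal {d} diagA zero =
    subst (λ e → OnDiagonal e 𝟏) (sym (ℤP.*-zeroˡ d)) 𝟏-onDiagonal
  pow-onDiagonal {d} diagA (suc j) =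
    subst (λ e → OnDiagonal e _) (sym (ℤP.suc-* (+ j) d))
      (·-onDiagonal {d} {+ j ℤ.* d} diagA (pow-onDiagonal diagA j))

  diagonalOffset≤n : ∀ (i j : Fin n) e → + idx j ≡ + idx i ℤ.+ e → ∣ e ∣ ≤ n
  diagonalOffset≤n i j e j≡i+e = begin
    ∣ e ∣                         ≡⟨ cong ∣_∣ (y≈x\\z (+ idx i) e (+ idx j) (sym j≡i+e)) ⟩
    ∣ ℤ.- + idx i ℤ.+ + idx j ∣   ≡⟨ cong ∣_∣ (ℤP.-m+n≡n⊖m (idx i) (idx j)) ⟩
    ∣ idx j ℤ.⊖ idx i ∣           ≤⟨ ℤP.∣m⊝n∣≤m⊔n (idx j) (idx i) ⟩
    idx j ℕ.⊔ idx i               ≤⟨ ⊔-lub (idx≤n j) (idx≤n i) ⟩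
    n                             ∎
    where open ≤-Reasoning

  onDiagonal-far⇒≈𝟎 : ∀ {e} {A : Mat n} → OnDiagonal e A → n < ∣ e ∣ → A ≈ 𝟎
  onDiagonal-far⇒≈𝟎 {e} {A} diagA n<e i j =
    decidable-stable (A i j ≟ 0) (λ Aij≢0 → <⇒≱ n<e (diagonalOffset≤n i j e (diagA i j Aij≢0)))

  -- A ^ (1 + n) lies on the diagonal (1 + n) · d, which misses every entry of an n × n matrix.
  onDiagonal-nilpotent : ∀ {d} {A : Mat n} → d ≢ + 0 → OnDiagonal d A → Nilpotent A
  onDiagonal-nilpotent {d} d≢0 diagA =
    n , onDiagonal-far⇒≈𝟎 {+ suc n ℤ.* d} (pow-onDiagonal {d} diagA (suc n)) far
    where
    instance
      ∣d∣≢0 : ℕ.NonZero ∣ d ∣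
      ∣d∣≢0 = ℕ.≢-nonZero (d≢0 ∘ ℤP.∣i∣≡0⇒i≡0)
    far : n < ∣ + suc n ℤ.* d ∣
    far = ≤-trans (m≤m*n (suc n) ∣ d ∣) (≤-reflexive (sym (ℤP.abs-* (+ suc n) d)))

  onDiagonal-unique : ∀ {d e} {A : Mat n} → OnDiagonal d A → OnDiagonal e A → ∀ i j → A i j ≢ 0 → d ≡ e
  onDiagonal-unique {d} {e} diagA diagA′ i j Aij≢0 =
    ∙-cancelˡ (+ idx i) d e (trans (sym (diagA i j Aij≢0)) (diagA′ i j Aij≢0))

  -- A = A · A lies on the diagonals d and d + d at once.
  onDiagonal-idempotent : ∀ {d} {A : Mat n} → OnDiagonal d A → Idempotent A → ∀ i j → A i j ≢ 0 → d ≡ + 0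
  onDiagonal-idempotent {d} {A} diagA idem i j Aij≢0 = identityʳ-unique d d (onDiagonal-unique diagAA diagA i j Aij≢0)
    where
    diagAA : OnDiagonal (d ℤ.+ d) A
    diagAA i j Aij≢0 = ·-onDiagonal {d} {d} diagA diagA i j (Aij≢0 ∘ trans (sym (idem i j)))

  -- The band matrices ⟨ d , k , m ⟩

  record OnBand (d : ℤ) (k m : ℕ) (i j : Fin n) : Set where
    constructor onBand
    field
      lower : k ≤ idx i
      upper : idx i ≤ m
      shift : + idx j ≡ + idx i ℤ.+ d

  onBand? : ∀ d k m i j → Dec (OnBand d k m i j)
  onBand? d k m i j =
    map′ (λ (k≤i , i≤m , j≡i+d) → onBand k≤i i≤m j≡i+d) (λ (onBand k≤i i≤m j≡i+d) → k≤i , i≤m , j≡i+d)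
    (k ≤? idx i ×-dec idx i ≤? m ×-dec + idx j ℤ.≟ + idx i ℤ.+ d)

  band-entry : ∀ d k m i j → ⟨ d , k , m ⟩ i j ≡ (if does (onBand? d k m i j) then 1 else 0)
  band-entry d k m i j = cong (λ t → if t then 1 else 0)
    (cong₂ _∧_ (isYes≗does (k ≤? idx i))
      (cong₂ _∧_ (isYes≗does (idx i ≤? m)) (isYes≗does (+ idx j ℤ.≟ + idx i ℤ.+ d))))

  band-onBand : ∀ {d k m i j} → OnBand d k m i j → ⟨ d , k , m ⟩ i j ≡ 1
  band-onBand {d} {k} {m} {i} {j} b =
    trans (band-entry d k m i j) (cong (λ t → if t then 1 else 0) (dec-true (onBand? d k m i j) b))

  band-offBand : ∀ {d k m i j} → ¬ OnBand d k m i j → ⟨ d , k , m ⟩ i j ≡ 0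
  band-offBand {d} {k} {m} {i} {j} ¬b =
    trans (band-entry d k m i j) (cong (λ t → if t then 1 else 0) (dec-false (onBand? d k m i j) ¬b))

  band≢0⇒onBand : ∀ {d k m i j} → ⟨ d , k , m ⟩ i j ≢ 0 → OnBand d k m i j
  band≢0⇒onBand {d} {k} {m} {i} {j} b≢0 =
    decidable-stable (onBand? d k m i j) (b≢0 ∘ band-offBand {d} {k} {m} {i} {j})

  band-onDiagonal : ∀ {d k m} → OnDiagonal d ⟨ d , k , m ⟩
  band-onDiagonal {d} {k} {m} i j = OnBand.shift ∘ band≢0⇒onBand {d} {k} {m} {i} {j}

i≤j-k⇔i+k≤j : ∀ i j k → (i ℤ.≤ j ℤ.- k) ⇔ (i ℤ.+ k ℤ.≤ j)
i≤j-k⇔i+k≤j i j k = mk⇔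
  (λ i≤j-k → subst (i ℤ.+ k ℤ.≤_) (//-rightDividesˡ k j) (ℤP.+-monoˡ-≤ k i≤j-k))
  (λ i+k≤j → subst (ℤ._≤ j ℤ.- k) (//-rightDividesʳ k i) (ℤP.+-monoˡ-≤ (ℤ.- k) i+k≤j))

admissible⁺ : ∀ {n a k m} → Admissible n (+ a) k m ⇔ (1 ≤ k × k ≤ m × m + a ≤ n)
admissible⁺ {n} {a} {k} {m} = mk⇔
  (λ (1≤k , k≤m , m≤n-a) →
    ℤP.drop‿+≤+ 1≤k , k≤m , ℤP.drop‿+≤+ (Equivalence.to (i≤j-k⇔i+k≤j (+ m) (+ n) (+ a)) m≤n-a))
  (λ (1≤k , k≤m , m+a≤n) →
    ℤ.+≤+ 1≤k , k≤m , Equivalence.from (i≤j-k⇔i+k≤j (+ m) (+ n) (+ a)) (ℤ.+≤+ m+a≤n))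

admissible⁻ : ∀ {n a k m} → Admissible n -[1+ a ] k m ⇔ (2 + a ≤ k × k ≤ m × m ≤ n)
admissible⁻ {n} = mk⇔
  (λ (2+a≤k , k≤m , m≤n+0) → ℤP.drop‿+≤+ 2+a≤k , k≤m , subst (_ ≤_) (+-identityʳ n) (ℤP.drop‿+≤+ m≤n+0))
  (λ (2+a≤k , k≤m , m≤n) → ℤ.+≤+ 2+a≤k , k≤m , ℤ.+≤+ (subst (_ ≤_) (sym (+-identityʳ n)) m≤n))

module _ {n : ℕ} where

  admissible-rows : ∀ {d k m} → Admissible n d k m → 1 ≤ k × k ≤ m × m ≤ n
  admissible-rows {+ a} adm with Equivalence.to admissible⁺ adm
  ... | 1≤k , k≤m , m+a≤n = 1≤k , k≤m , ≤-trans (m≤m+n _ a) m+a≤n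
  admissible-rows { -[1+ a ]} adm with Equivalence.to admissible⁻ adm
  ... | 2+a≤k , k≤m , m≤n = ≤-trans (s≤s z≤n) 2+a≤k , k≤m , m≤n

  admissible-column : ∀ {d k m r} → Admissible n d k m → k ≤ r → r ≤ m →
                      ∃ λ c → + c ≡ + r ℤ.+ d × 1 ≤ c × c ≤ n
  admissible-column {+ a} {r = r} adm k≤r r≤m with Equivalence.to admissible⁺ adm
  ... | 1≤k , _ , m+a≤n =
    r + a , refl , ≤-trans (≤-trans 1≤k k≤r) (m≤m+n r a) , ≤-trans (+-monoˡ-≤ a r≤m) m+a≤n
  admissible-column { -[1+ a ]} {r = r} adm k≤r r≤m with Equivalence.to admissible⁻ adm
  ... | 2+a≤k , _ , m≤n =
    r ∸ suc a , sym (ℤP.⊖-≥ (<⇒≤ 1+a<r)) , m<n⇒0<n∸m 1+a<r , ≤-trans (m∸n≤m r (suc a)) (≤-trans r≤m m≤n)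
    where 1+a<r = ≤-trans 2+a≤k k≤r

module _ {n : ℕ} {d : ℤ} {k m : ℕ} (adm : Admissible n d k m) where

  band-entryInRow : ∀ {r} → k ≤ r → r ≤ m → ∃₂ λ (i j : Fin n) → idx i ≡ r × OnBand d k m i j
  band-entryInRow k≤r r≤m with admissible-rows {d = d} adm | admissible-column {d = d} adm k≤r r≤m
  ... | 1≤k , _ , m≤n | c , c≡r+d , 1≤c , c≤n
    with fromIdx (≤-trans 1≤k k≤r) (≤-trans r≤m m≤n) | fromIdx 1≤c c≤n
  ...  | i , refl | j , refl = i , j , refl , onBand k≤r r≤m c≡r+d

  band-hasEntry : ∃₂ λ (i j : Fin n) → OnBand d k m i j
  band-hasEntry with band-entryInRow ≤-refl (proj₁ (proj₂ (admissible-rows {d = d} adm)))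
  ... | i , j , _ , b = i , j , b

  band≉𝟎 : ¬ ⟨ d , k , m ⟩ ≈ 𝟎
  band≉𝟎 A≈𝟎 with band-hasEntry
  ... | i , j , b = 1+n≢0 (trans (sym (band-onBand b)) (A≈𝟎 i j))

  band-≈-bounds : ∀ {d′ k′ m′} → ⟨ d , k , m ⟩ ≈ ⟨ d′ , k′ , m′ ⟩ → d ≡ d′ × k′ ≤ k × m ≤ m′
  band-≈-bounds {d′} {k′} {m′} A≈B =
    proj₁ (row ≤-refl k≤m) , proj₁ (proj₂ (row ≤-refl k≤m)) , proj₂ (proj₂ (row k≤m ≤-refl))
    where
    k≤m = proj₁ (proj₂ (admissible-rows {d = d} adm))
    row : ∀ {r} → k ≤ r → r ≤ m → d ≡ d′ × k′ ≤ r × r ≤ m′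
    row k≤r r≤m with band-entryInRow k≤r r≤m
    ... | i , j , refl , onA@(onBand _ _ j≡i+d)
      with band≢0⇒onBand {d = d′} {k = k′} {m = m′}
             (λ B≡0 → 1+n≢0 (trans (sym (band-onBand onA)) (trans (A≈B i j) B≡0)))
    ...   | onBand k′≤i i≤m′ j≡i+d′ = ∙-cancelˡ (+ idx i) d d′ (trans (sym j≡i+d) j≡i+d′) , k′≤i , i≤m′

  band-idempotent⇒ : Idempotent ⟨ d , k , m ⟩ → d ≡ + 0
  band-idempotent⇒ idem with band-hasEntry
  ... | i , j , b = onDiagonal-idempotent {d = d} (band-onDiagonal {d = d} {k} {m}) idem i j
                      (1+n≢0 ∘ trans (sym (band-onBand b)))

Triple : Set
Triple = ℤ × ℕ × ℕ

band : ∀ {n} → Triple → Mat n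
band (d , k , m) = ⟨ d , k , m ⟩

AdmissibleTriple : ℕ → Triple → Set
AdmissibleTriple n (d , k , m) = Admissible n d k m

band-injective : ∀ {n} s t → AdmissibleTriple n s → AdmissibleTriple n t → band {n} s ≈ band t → s ≡ t
band-injective (d , k , m) (d′ , k′ , m′) adm adm′ s≈t
  with band-≈-bounds {d = d} {k} {m} adm {d′} {k′} {m′} s≈t
     | band-≈-bounds {d = d′} {k′} {m′} adm′ {d} {k} {m} (≈-sym s≈t)
... | refl , k′≤k , m≤m′ | _ , k≤k′ , m′≤m =
  cong₂ (λ k m → d , k , m) (≤-antisym k≤k′ k′≤k) (≤-antisym m≤m′ m′≤m)

module _ {n : ℕ} where

  𝟏≈band : 𝟏 {n} ≈ ⟨ + 0 , 1 , n ⟩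
  𝟏≈band i j with toℕ i ℕ.≟ toℕ j
  ... | yes i≡j = sym (band-onBand {d = + 0} {1} {n}
    (onBand (s≤s z≤n) (idx≤n i) (Equivalence.from shift₀⇔≡ (FinP.toℕ-injective (sym i≡j)))))
  ... | no  i≢j = sym (band-offBand {d = + 0} {1} {n}
    λ (onBand _ _ j≡i) → i≢j (cong toℕ (sym (Equivalence.to shift₀⇔≡ j≡i))))

  band≈𝟏⇒ : ∀ {d k m} → Admissible n d k m → ⟨ d , k , m ⟩ ≈ 𝟏 → (d , k , m) ≡ (+ 0 , 1 , n)
  band≈𝟏⇒ {d} {k} {m} adm A≈𝟏 = band-injective (d , k , m) (+ 0 , 1 , n) adm unitAdm (≈-trans A≈𝟏 𝟏≈band)
    where
    unitAdm : Admissible n (+ 0) 1 n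
    unitAdm with admissible-rows {d = d} adm
    ... | 1≤k , k≤m , m≤n = Equivalence.from admissible⁺
      (≤-refl , ≤-trans 1≤k (≤-trans k≤m m≤n) , ≤-reflexive (+-identityʳ n))

  band₀-rowUnit : ∀ {k m} (B : Mat n) i j → k ≤ idx i → idx i ≤ m → (⟨ + 0 , k , m ⟩ · B) i j ≡ B i j
  band₀-rowUnit {k} {m} B i j k≤i i≤m = ·-unitRow ⟨ + 0 , k , m ⟩ B i i j
    (λ l l≢i → band-offBand {d = + 0} {k} {m} λ (onBand _ _ l≡i) → l≢i (Equivalence.to shift₀⇔≡ l≡i))
    (band-onBand {d = + 0} {k} {m} (onBand k≤i i≤m (Equivalence.from shift₀⇔≡ refl)))

  band₀-idempotent : ∀ {k m} → Idempotent {n} ⟨ + 0 , k , m ⟩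
  band₀-idempotent {k} {m} i j with k ≤? idx i ×-dec idx i ≤? m
  ... | yes (k≤i , i≤m) = band₀-rowUnit ⟨ + 0 , k , m ⟩ i j k≤i i≤m
  ... | no ¬k≤i≤m = trans (·-zeroRow ⟨ + 0 , k , m ⟩ ⟨ + 0 , k , m ⟩ i j rowZero) (sym (rowZero j))
    where
    rowZero : ∀ l → ⟨ + 0 , k , m ⟩ i l ≡ 0
    rowZero l = band-offBand {d = + 0} {k} {m} λ (onBand k≤i i≤m _) → ¬k≤i≤m (k≤i , i≤m)

  band₀-pow-diagonal : ∀ {k m} i → k ≤ idx i → idx i ≤ m → ∀ j → pow ⟨ + 0 , k , m ⟩ j i i ≡ 1
  band₀-pow-diagonal i k≤i i≤m zero =
    trans (𝟏≈band i i)
      (band-onBand {d = + 0} {1} {n} (onBand (s≤s z≤n) (idx≤n i) (Equivalence.from shift₀⇔≡ refl)))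
  band₀-pow-diagonal {k} {m} i k≤i i≤m (suc j) =
    trans (band₀-rowUnit {k} {m} (pow ⟨ + 0 , k , m ⟩ j) i i k≤i i≤m) (band₀-pow-diagonal i k≤i i≤m j)

  band₀-not-nilpotent : ∀ {k m} → Admissible n (+ 0) k m → ¬ Nilpotent ⟨ + 0 , k , m ⟩
  band₀-not-nilpotent {k} {m} adm (j , Aʲ≈𝟎) with band-hasEntry {d = + 0} {k} {m} adm
  ... | i , _ , onBand k≤i i≤m _ = 1+n≢0 (trans (sym (band₀-pow-diagonal i k≤i i≤m (suc j))) (Aʲ≈𝟎 i i))

  band-nilpotent⇒ : ∀ {d k m} → Admissible n d k m → Nilpotent ⟨ d , k , m ⟩ → d ≢ + 0
  band-nilpotent⇒ {d} {k} {m} adm nil d≡0 = band₀-not-nilpotent {k = k} {m}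
    (subst (λ x → Admissible n x k m) d≡0 adm) (subst (λ x → Nilpotent {n} ⟨ x , k , m ⟩) d≡0 nil)

  band-nilpotent : ∀ {d k m} → d ≢ + 0 → Nilpotent {n} ⟨ d , k , m ⟩
  band-nilpotent {d} {k} {m} d≢0 = onDiagonal-nilpotent {d = d} d≢0 (band-onDiagonal {d = d} {k} {m})

-- Counting elements of S_n through their band parameters

bands-distinct : ∀ {n} ts → Unique ts → All (AdmissibleTriple n) ts →
                 AllPairs (λ A B → ¬ A ≈ B) (map (band {n}) ts)
bands-distinct []       []             []           = []
bands-distinct (t ∷ ts) (t∉ts ∷ uniq) (adm ∷ adms) =
  AllP.map⁺ (All.zipWith (λ {t′} (t≢t′ , adm′) t≈t′ → t≢t′ (band-injective t t′ adm adm′ t≈t′))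
                         (t∉ts , adms))
  ∷ bands-distinct ts uniq adms

identityTriple : ℕ → Triple
identityTriple n = + 0 , 1 , n

module _ {n : ℕ} where

  inS-view : ∀ {A} → InS n A → A ≈ 𝟎 ⊎ Σ Triple λ t → AdmissibleTriple n t × t ≢ identityTriple n × A ≈ band t
  inS-view (inj₁ A≈𝟎 , _) = inj₁ A≈𝟎
  inS-view (inj₂ (d , k , m , adm , A≈t) , A≉𝟏) =
    inj₂ ((d , k , m) , adm , (λ { refl → A≉𝟏 (≈-trans A≈t (≈-sym 𝟏≈band)) }) , A≈t)

  band-inS : ∀ t → AdmissibleTriple n t → t ≢ identityTriple n → InS n (band t)
  band-inS (d , k , m) adm t≢𝟏 = inj₂ (d , k , m , adm , λ _ _ → refl) , t≢𝟏 ∘ band≈𝟏⇒ adm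

𝟎-inS : ∀ {p} → InS (suc p) 𝟎
𝟎-inS = inj₁ (λ _ _ → refl) , λ 𝟎≈𝟏 → 0≢1+n (𝟎≈𝟏 fzero fzero)

hasExactly-inS : ∀ {p} (Q : Mat (suc p) → Set) → (∀ {A B} → A ≈ B → Q A → Q B) → Q 𝟎 →
  (ts : List Triple) → Unique ts →
  (∀ {t} → t ∈ ts → AdmissibleTriple (suc p) t × t ≢ identityTriple (suc p) × Q (band t)) →
  (∀ t → AdmissibleTriple (suc p) t → t ≢ identityTriple (suc p) → Q (band t) → t ∈ ts) →
  HasExactly (λ A → InS (suc p) A × Q A) (suc (length ts))
hasExactly-inS Q Q-resp Q𝟎 ts uniq sound complete =
  𝟎 ∷ map band ts ,
  cong suc (length-map band ts) ,
  (𝟎-inS , Q𝟎) ∷ AllP.map⁺ (All.tabulate λ {t} t∈ts →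
    let (adm , t≢𝟏 , Qt) = sound t∈ts in band-inS t adm t≢𝟏 , Qt) ,
  AllP.map⁺ (All.tabulate λ { {d , k , m} t∈ts 𝟎≈t → band≉𝟎 {d = d} {k} {m} (proj₁ (sound t∈ts)) (≈-sym 𝟎≈t) })
    ∷ bands-distinct ts uniq (All.tabulate (proj₁ ∘ sound)) ,
  λ A (A∈S , QA) → [ here , (λ (t , adm , t≢𝟏 , A≈t) →
      there (AnyP.map⁺ (lose (complete t adm t≢𝟏 (Q-resp A≈t QA)) A≈t))) ]′ (inS-view A∈S)

-- Row intervals [k, m]

triangular : ℕ → ℕ
triangular zero    = 0
triangular (suc N) = triangular N + suc N

tetrahedral : ℕ → ℕ
tetrahedral zero    = 0
tetrahedral (suc N) = tetrahedral N + triangular (suc N)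

intervalsEndingAt : ℕ → ℕ → ℕ → List (ℕ × ℕ)
intervalsEndingAt m lo c = applyUpTo (λ i → lo + i , m) c

∈-intervalsEndingAt⁻ : ∀ {m lo c k m′} → (k , m′) ∈ intervalsEndingAt m lo c → lo ≤ k × k < lo + c × m′ ≡ m
∈-intervalsEndingAt⁻ {m} {lo} km∈ with ∈-applyUpTo⁻ (λ i → lo + i , m) km∈
... | i , i<c , refl = m≤m+n lo i , +-monoʳ-< lo i<c , refl

∈-intervalsEndingAt⁺ : ∀ {m lo c k} → lo ≤ k → k < lo + c → (k , m) ∈ intervalsEndingAt m lo c
∈-intervalsEndingAt⁺ {m} {lo} {c} {k} lo≤k k<lo+c =
  subst (λ x → (x , m) ∈ intervalsEndingAt m lo c) (m+[n∸m]≡n lo≤k) (∈-applyUpTo⁺ (λ i → lo + i , m) k∸lo<c)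
  where
  k∸lo<c : k ∸ lo < c
  k∸lo<c = subst (k ∸ lo <_) (m+n∸m≡n lo c) (∸-monoˡ-< k<lo+c lo≤k)

intervalsEndingAt-unique : ∀ m lo c → Unique (intervalsEndingAt m lo c)
intervalsEndingAt-unique m lo c =
  UniqueP.applyUpTo⁺₁ _ c (λ i<j _ eq → <⇒≢ i<j (+-cancelˡ-≡ lo _ _ (cong proj₁ eq)))

length-intervalsEndingAt : ∀ m lo c → length (intervalsEndingAt m lo c) ≡ c
length-intervalsEndingAt m lo = length-applyUpTo _

intervals : ℕ → List (ℕ × ℕ)
intervals zero    = []
intervals (suc N) = intervals N ++ intervalsEndingAt (suc N) 1 (suc N)

∈-intervals⁻ : ∀ {N k m} → (k , m) ∈ intervals N → 1 ≤ k × k ≤ m × m ≤ N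
∈-intervals⁻ {suc N} km∈ with ∈-++⁻ (intervals N) km∈
... | inj₁ km∈ˡ = let (1≤k , k≤m , m≤N) = ∈-intervals⁻ km∈ˡ in 1≤k , k≤m , m≤n⇒m≤1+n m≤N
... | inj₂ km∈ʳ with ∈-intervalsEndingAt⁻ km∈ʳ
...   | 1≤k , s≤s k≤N , refl = 1≤k , k≤N , ≤-refl

∈-intervals⁺ : ∀ {N k m} → 1 ≤ k → k ≤ m → m ≤ N → (k , m) ∈ intervals N
∈-intervals⁺ {zero}  1≤k k≤m m≤0 = ⊥-elim (<⇒≱ (≤-trans 1≤k k≤m) m≤0)
∈-intervals⁺ {suc N} 1≤k k≤m m≤1+N with m≤n⇒m<n∨m≡n m≤1+N
... | inj₁ m<1+N = ∈-++⁺ˡ (∈-intervals⁺ 1≤k k≤m (s≤s⁻¹ m<1+N))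
... | inj₂ refl  = ∈-++⁺ʳ (intervals N) (∈-intervalsEndingAt⁺ 1≤k (s≤s k≤m))

intervals-unique : ∀ N → Unique (intervals N)
intervals-unique zero    = []
intervals-unique (suc N) = UniqueP.++⁺ (intervals-unique N) (intervalsEndingAt-unique (suc N) 1 (suc N))
  λ { {k , m} (km∈ˡ , km∈ʳ) →
      1+n≰n (subst (_≤ N) (proj₂ (proj₂ (∈-intervalsEndingAt⁻ km∈ʳ))) (proj₂ (proj₂ (∈-intervals⁻ km∈ˡ)))) }

length-intervals : ∀ N → length (intervals N) ≡ triangular N
length-intervals zero    = refl
length-intervals (suc N) =
  trans (length-++ (intervals N)) (cong₂ _+_ (length-intervals N) (length-intervalsEndingAt (suc N) 1 (suc N)))

properIntervals : ℕ → List (ℕ × ℕ)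
properIntervals p = intervals p ++ intervalsEndingAt (suc p) 2 p

∈-properIntervals⁻ : ∀ {p k m} → (k , m) ∈ properIntervals p →
                     1 ≤ k × k ≤ m × m ≤ suc p × (k , m) ≢ (1 , suc p)
∈-properIntervals⁻ {p} km∈ with ∈-++⁻ (intervals p) km∈
... | inj₁ km∈ˡ = let (1≤k , k≤m , m≤p) = ∈-intervals⁻ km∈ˡ in
  1≤k , k≤m , m≤n⇒m≤1+n m≤p , λ { refl → 1+n≰n m≤p }
... | inj₂ km∈ʳ with ∈-intervalsEndingAt⁻ km∈ʳ
...   | 2≤k , s≤s k≤1+p , refl = ≤-trans (n≤1+n 1) 2≤k , k≤1+p , ≤-refl , λ { refl → 1+n≰n 2≤k }

∈-properIntervals⁺ : ∀ {p k m} → 1 ≤ k → k ≤ m → m ≤ suc p → (k , m) ≢ (1 , suc p) →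
                     (k , m) ∈ properIntervals p
∈-properIntervals⁺ {p} 1≤k k≤m m≤1+p km≢ with m≤n⇒m<n∨m≡n m≤1+p
... | inj₁ m<1+p = ∈-++⁺ˡ (∈-intervals⁺ 1≤k k≤m (s≤s⁻¹ m<1+p))
... | inj₂ refl  = ∈-++⁺ʳ (intervals p)
  (∈-intervalsEndingAt⁺ (≤∧≢⇒< 1≤k λ 1≡k → km≢ (cong (_, suc p) (sym 1≡k))) (s≤s k≤m))

properIntervals-unique : ∀ p → Unique (properIntervals p)
properIntervals-unique p = UniqueP.++⁺ (intervals-unique p) (intervalsEndingAt-unique (suc p) 2 p)
  λ { {k , m} (km∈ˡ , km∈ʳ) →
      1+n≰n (subst (_≤ p) (proj₂ (proj₂ (∈-intervalsEndingAt⁻ km∈ʳ))) (proj₂ (proj₂ (∈-intervals⁻ km∈ˡ)))) }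

-- Idempotents

mainBand : ℕ × ℕ → Triple
mainBand (k , m) = + 0 , k , m

idempotentTriples : ℕ → List Triple
idempotentTriples p = map mainBand (properIntervals p)

-- d ≡ + 0 is an argument rather than matched on next to an Idempotent ⟨ d , k , m ⟩ hypothesis:
-- unifying inside that hypothesis unfolds the matrix entries and makes type checking explode.
∈-idempotentTriples⁺ : ∀ {p d k m} → d ≡ + 0 → Admissible (suc p) d k m → (d , k , m) ≢ identityTriple (suc p) →
                       (d , k , m) ∈ idempotentTriples p
∈-idempotentTriples⁺ {p} {k = k} {m} refl adm t≢𝟏 with Equivalence.to (admissible⁺ {suc p} {0} {k} {m}) adm
... | 1≤k , k≤m , m+0≤1+p = ∈-map⁺ mainBand
  (∈-properIntervals⁺ 1≤k k≤m (subst (_≤ suc p) (+-identityʳ m) m+0≤1+p) (t≢𝟏 ∘ cong mainBand))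

idempotents : ∀ p → HasExactly (λ A → InS (suc p) A × Idempotent A) (suc (length (idempotentTriples p)))
idempotents p = hasExactly-inS Idempotent idempotent-resp-≈ (λ i j → ·-zeroRow {suc p} 𝟎 𝟎 i j λ _ → refl)
  (idempotentTriples p) (UniqueP.map⁺ (cong proj₂) (properIntervals-unique p)) sound complete
  where
  sound : ∀ {t} → t ∈ idempotentTriples p →
          AdmissibleTriple (suc p) t × t ≢ identityTriple (suc p) × Idempotent (band t)
  sound t∈ with ∈-map⁻ mainBand t∈
  ... | (k , m) , km∈ , refl with ∈-properIntervals⁻ km∈
  ...   | 1≤k , k≤m , m≤1+p , km≢ =
    Equivalence.from (admissible⁺ {suc p} {0} {k} {m}) (1≤k , k≤m , subst (_≤ suc p) (sym (+-identityʳ m)) m≤1+p) ,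
    km≢ ∘ cong proj₂ , band₀-idempotent {k = k} {m}
  complete : ∀ t → AdmissibleTriple (suc p) t → t ≢ identityTriple (suc p) → Idempotent (band t) →
             t ∈ idempotentTriples p
  complete (d , k , m) adm t≢𝟏 idem = ∈-idempotentTriples⁺ (band-idempotent⇒ {d = d} {k} {m} adm idem) adm t≢𝟏

-- Nilpotents

upperBand lowerBand : ℕ → ℕ × ℕ → Triple
upperBand a (k , m) = + suc a , k , m
lowerBand a (k , m) = -[1+ a ] , suc a + k , suc a + m

-- In an n × n matrix with n = 1 + q + a, the bands with ∣ d ∣ = 1 + a have their rows [k, m] in a
-- window of q rows: [1, q] for d > 0 and [2 + a, 1 + q + a] for d < 0.
block : ℕ → ℕ → List Triple
block a q = map (upperBand a) (intervals q) ++ map (lowerBand a) (intervals q)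

∈-block⁻ : ∀ {p a q t} → t ∈ block a q → q + a ≤ p → AdmissibleTriple (suc p) t × ∣ proj₁ t ∣ ≡ suc a
∈-block⁻ {p} {a} {q} t∈ q+a≤p with ∈-++⁻ (map (upperBand a) (intervals q)) t∈
... | inj₁ t∈ᵘ with ∈-map⁻ (upperBand a) t∈ᵘ
...   | (k , m) , km∈ , refl with ∈-intervals⁻ km∈
...     | 1≤k , k≤m , m≤q = Equivalence.from (admissible⁺ {suc p} {suc a} {k} {m})
  (1≤k , k≤m , subst (_≤ suc p) (sym (+-suc m a)) (s≤s (≤-trans (+-monoˡ-≤ a m≤q) q+a≤p))) , refl
∈-block⁻ {p} {a} {q} t∈ q+a≤p | inj₂ t∈ˡ with ∈-map⁻ (lowerBand a) t∈ˡ
...   | (k , m) , km∈ , refl with ∈-intervals⁻ km∈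
...     | 1≤k , k≤m , m≤q = Equivalence.from (admissible⁻ {suc p} {a} {suc a + k} {suc a + m})
  (subst (_≤ suc a + k) (+-comm (suc a) 1) (+-monoʳ-≤ (suc a) 1≤k) , +-monoʳ-≤ (suc a) k≤m ,
   s≤s (≤-trans (+-monoʳ-≤ a m≤q) (subst (_≤ p) (+-comm q a) q+a≤p))) , refl

block-unique : ∀ a q → Unique (block a q)
block-unique a q = UniqueP.++⁺ (UniqueP.map⁺ (cong proj₂) (intervals-unique q))
  (UniqueP.map⁺ lowerBand-injective (intervals-unique q)) upper∩lower≡∅
  where
  lowerBand-injective : ∀ {x y} → lowerBand a x ≡ lowerBand a y → x ≡ y
  lowerBand-injective {k , m} {k′ , m′} eq =
    cong₂ _,_ (+-cancelˡ-≡ (suc a) k k′ (cong (proj₁ ∘ proj₂) eq)) (+-cancelˡ-≡ (suc a) m m′ (cong (proj₂ ∘ proj₂) eq))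
  upper∩lower≡∅ : ∀ {t} → ¬ (t ∈ map (upperBand a) (intervals q) × t ∈ map (lowerBand a) (intervals q))
  upper∩lower≡∅ (t∈ᵘ , t∈ˡ) with ∈-map⁻ (upperBand a) t∈ᵘ | ∈-map⁻ (lowerBand a) t∈ˡ
  ... | _ , _ , refl | _ , _ , ()

length-block : ∀ a q → length (block a q) ≡ triangular q + triangular q
length-block a q = trans (length-++ (map (upperBand a) (intervals q)))
  (cong₂ _+_ (trans (length-map (upperBand a) (intervals q)) (length-intervals q))
             (trans (length-map (lowerBand a) (intervals q)) (length-intervals q)))

nilpotentTriples : ℕ → ℕ → List Triple
nilpotentTriples p zero    = []
nilpotentTriples p (suc q) = nilpotentTriples p q ++ block (p ∸ suc q) (suc q)

∈-nilpotentTriples⁻ : ∀ {p q t} → t ∈ nilpotentTriples p q → q ≤ p →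
                      AdmissibleTriple (suc p) t × p ∸ q < ∣ proj₁ t ∣
∈-nilpotentTriples⁻ {p} {suc q} t∈ 1+q≤p with ∈-++⁻ (nilpotentTriples p q) t∈
... | inj₁ t∈ˡ = let (adm , p∸q<∣d∣) = ∈-nilpotentTriples⁻ t∈ˡ (<⇒≤ 1+q≤p) in
  adm , ≤-<-trans (∸-monoʳ-≤ p (n≤1+n q)) p∸q<∣d∣
... | inj₂ t∈ʳ = let (adm , ∣d∣≡) = ∈-block⁻ t∈ʳ (≤-reflexive (m+[n∸m]≡n 1+q≤p)) in
  adm , subst (p ∸ suc q <_) (sym ∣d∣≡) (n<1+n _)

nilpotentTriples-unique : ∀ p q → q ≤ p → Unique (nilpotentTriples p q)
nilpotentTriples-unique p zero    _     = []
nilpotentTriples-unique p (suc q) 1+q≤p =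
  UniqueP.++⁺ (nilpotentTriples-unique p q (<⇒≤ 1+q≤p)) (block-unique (p ∸ suc q) (suc q))
    λ (t∈ˡ , t∈ʳ) → <-irrefl
      (trans (+-∸-assoc 1 1+q≤p) (sym (proj₂ (∈-block⁻ t∈ʳ (≤-reflexive (m+[n∸m]≡n 1+q≤p))))))
      (proj₂ (∈-nilpotentTriples⁻ t∈ˡ (<⇒≤ 1+q≤p)))

block⊆nilpotentTriples : ∀ {p q r a t} → 1 ≤ q → q ≤ r → q + a ≡ p → t ∈ block a q → t ∈ nilpotentTriples p r
block⊆nilpotentTriples {r = zero} 1≤q q≤0 _ _ = ⊥-elim (<⇒≱ 1≤q q≤0)
block⊆nilpotentTriples {p} {q} {suc r} {a} {t} 1≤q q≤1+r q+a≡p t∈ with m≤n⇒m<n∨m≡n q≤1+r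
... | inj₁ q<1+r = ∈-++⁺ˡ (block⊆nilpotentTriples 1≤q (s≤s⁻¹ q<1+r) q+a≡p t∈)
... | inj₂ refl  = ∈-++⁺ʳ (nilpotentTriples p r) (subst (λ x → t ∈ block x q) a≡p∸q t∈)
  where
  a≡p∸q : a ≡ p ∸ q
  a≡p∸q = trans (sym (m+n∸m≡n q a)) (cong (_∸ q) q+a≡p)

length-nilpotentTriples : ∀ p q → length (nilpotentTriples p q) ≡ tetrahedral q * 2
length-nilpotentTriples p zero    = refl
length-nilpotentTriples p (suc q) = begin
  length (nilpotentTriples p q ++ block (p ∸ suc q) (suc q))
    ≡⟨ length-++ (nilpotentTriples p q) ⟩
  length (nilpotentTriples p q) + length (block (p ∸ suc q) (suc q))
    ≡⟨ cong₂ _+_ (length-nilpotentTriples p q) (length-block (p ∸ suc q) (suc q)) ⟩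
  tetrahedral q * 2 + (triangular (suc q) + triangular (suc q))
    ≡⟨ regroup (tetrahedral q) (triangular (suc q)) ⟩
  tetrahedral (suc q) * 2 ∎
  where
  open ≡-Reasoning
  regroup : ∀ x y → x * 2 + (y + y) ≡ (x + y) * 2
  regroup = solve-∀

∈-nilpotentTriples⁺ : ∀ {p} t → AdmissibleTriple (suc p) t → proj₁ t ≢ + 0 → t ∈ nilpotentTriples p p
∈-nilpotentTriples⁺ (+ zero , k , m) _ d≢0 = ⊥-elim (d≢0 refl)
∈-nilpotentTriples⁺ {p} (+ suc a , k , m) adm _ with Equivalence.to (admissible⁺ {suc p} {suc a} {k} {m}) adm
... | 1≤k , k≤m , m+1+a≤1+p =
  block⊆nilpotentTriples (m<n⇒0<n∸m a<p) (m∸n≤m p a) (m∸n+n≡m (<⇒≤ a<p))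
    (∈-++⁺ˡ (∈-map⁺ (upperBand a) (∈-intervals⁺ 1≤k k≤m (m+n≤o⇒m≤o∸n m m+a≤p))))
  where
  m+a≤p : m + a ≤ p
  m+a≤p = s≤s⁻¹ (subst (_≤ suc p) (+-suc m a) m+1+a≤1+p)
  a<p : a < p
  a<p = ≤-trans (+-monoˡ-≤ a (≤-trans 1≤k k≤m)) m+a≤p
∈-nilpotentTriples⁺ {p} (-[1+ a ] , k , m) adm _ with Equivalence.to (admissible⁻ {suc p} {a} {k} {m}) adm
... | 2+a≤k , k≤m , m≤1+p =
  block⊆nilpotentTriples (m<n⇒0<n∸m a<p) (m∸n≤m p a) (m∸n+n≡m (<⇒≤ a<p))
    (subst (_∈ block a (p ∸ a)) unshift
      (∈-++⁺ʳ (map (upperBand a) (intervals (p ∸ a))) (∈-map⁺ (lowerBand a)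
        (∈-intervals⁺ (m<n⇒0<n∸m 2+a≤k) (∸-monoˡ-≤ (suc a) k≤m) (∸-monoˡ-≤ (suc a) m≤1+p)))))
  where
  a<p : a < p
  a<p = s≤s⁻¹ (≤-trans 2+a≤k (≤-trans k≤m m≤1+p))
  unshift : lowerBand a (k ∸ suc a , m ∸ suc a) ≡ (-[1+ a ] , k , m)
  unshift = cong₂ (λ k m → -[1+ a ] , k , m) (m+[n∸m]≡n (<⇒≤ 2+a≤k)) (m+[n∸m]≡n (<⇒≤ (≤-trans 2+a≤k k≤m)))

nilpotents : ∀ p → HasExactly (λ A → InS (suc p) A × Nilpotent A) (suc (length (nilpotentTriples p p)))
nilpotents p = hasExactly-inS Nilpotent nilpotent-resp-≈ (0 , λ i j → ·-zeroRow {suc p} 𝟎 𝟏 i j λ _ → refl)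
  (nilpotentTriples p p) (nilpotentTriples-unique p p ≤-refl) sound complete
  where
  sound : ∀ {t} → t ∈ nilpotentTriples p p →
          AdmissibleTriple (suc p) t × t ≢ identityTriple (suc p) × Nilpotent (band t)
  sound {d , k , m} t∈ with ∈-nilpotentTriples⁻ t∈ ≤-refl
  ... | adm , p∸p<∣d∣ = adm , d≢0 ∘ cong proj₁ , band-nilpotent {d = d} {k} {m} d≢0
    where
    d≢0 : d ≢ + 0
    d≢0 d≡0 = <⇒≱ p∸p<∣d∣ (subst (_≤ p ∸ p) (cong ∣_∣ (sym d≡0)) z≤n)
  complete : ∀ t → AdmissibleTriple (suc p) t → t ≢ identityTriple (suc p) → Nilpotent (band t) →
             t ∈ nilpotentTriples p p
  complete (d , k , m) adm _ nil = ∈-nilpotentTriples⁺ (d , k , m) adm (band-nilpotent⇒ {d = d} {k} {m} adm nil)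

triangular-closed : ∀ N → triangular N * 2 ≡ N * suc N
triangular-closed zero    = refl
triangular-closed (suc N) = begin
  (triangular N + suc N) * 2    ≡⟨ *-distribʳ-+ 2 (triangular N) (suc N) ⟩
  triangular N * 2 + suc N * 2  ≡⟨ cong (_+ suc N * 2) (triangular-closed N) ⟩
  N * suc N + suc N * 2         ≡⟨ step N ⟩
  suc N * suc (suc N)           ∎
  where
  open ≡-Reasoning
  step : ∀ N → N * suc N + suc N * 2 ≡ suc N * suc (suc N)
  step = solve-∀

tetrahedral-closed : ∀ N → tetrahedral N * 6 + suc N ≡ suc N ^ 3
tetrahedral-closed zero    = refl
tetrahedral-closed (suc N) = begin
  (tetrahedral N + triangular (suc N)) * 6 + suc (suc N)
    ≡⟨ regroup (tetrahedral N) (triangular (suc N)) N ⟩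
  (tetrahedral N * 6 + suc N) + triangular (suc N) * 2 * 3 + 1
    ≡⟨ cong₂ (λ x y → x + y * 3 + 1) (tetrahedral-closed N) (triangular-closed (suc N)) ⟩
  suc N ^ 3 + suc N * suc (suc N) * 3 + 1
    ≡⟨ step N ⟩
  suc (suc N) ^ 3 ∎
  where
  open ≡-Reasoning
  regroup : ∀ x y N → (x + y) * 6 + suc (suc N) ≡ (x * 6 + suc N) + y * 2 * 3 + 1
  regroup = solve-∀
  step : ∀ N → (1 + N) * ((1 + N) * ((1 + N) * 1)) + (1 + N) * (2 + N) * 3 + 1
                ≡ (2 + N) * ((2 + N) * ((2 + N) * 1))
  step = solve-∀

idempotent-count : ∀ p → suc (length (idempotentTriples p)) ≡ (suc p * suc (suc p)) / 2
idempotent-count p = begin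
  suc (length (idempotentTriples p))
    ≡⟨ cong suc (length-map mainBand (properIntervals p)) ⟩
  suc (length (intervals p ++ intervalsEndingAt (suc p) 2 p))
    ≡⟨ cong suc (length-++ (intervals p)) ⟩
  suc (length (intervals p) + length (intervalsEndingAt (suc p) 2 p))
    ≡⟨ cong suc (cong₂ _+_ (length-intervals p) (length-intervalsEndingAt (suc p) 2 p)) ⟩
  suc (triangular p + p)
    ≡⟨ sym (+-suc (triangular p) p) ⟩
  triangular (suc p)
    ≡⟨ sym (m*n/n≡m (triangular (suc p)) 2) ⟩
  triangular (suc p) * 2 / 2
    ≡⟨ cong (_/ 2) (triangular-closed (suc p)) ⟩
  suc p * suc (suc p) / 2 ∎
  where open ≡-Reasoning

nilpotent-count : ∀ p → suc (length (nilpotentTriples p p)) ≡ (suc p ^ 3 ∸ suc p) / 3 + 1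
nilpotent-count p = begin
  suc (length (nilpotentTriples p p))      ≡⟨ cong suc (length-nilpotentTriples p p) ⟩
  suc (tetrahedral p * 2)                   ≡⟨ +-comm 1 (tetrahedral p * 2) ⟩
  tetrahedral p * 2 + 1                     ≡⟨ cong (_+ 1) (sym (m*n/n≡m (tetrahedral p * 2) 3)) ⟩
  tetrahedral p * 2 * 3 / 3 + 1             ≡⟨ cong (λ x → x / 3 + 1) sextuple ⟩
  (suc p ^ 3 ∸ suc p) / 3 + 1               ∎
  where
  open ≡-Reasoning
  sextuple : tetrahedral p * 2 * 3 ≡ suc p ^ 3 ∸ suc p
  sextuple = begin
    tetrahedral p * 2 * 3                   ≡⟨ *-assoc (tetrahedral p) 2 3 ⟩
    tetrahedral p * 6                       ≡⟨ sym (m+n∸n≡m (tetrahedral p * 6) (suc p)) ⟩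
    tetrahedral p * 6 + suc p ∸ suc p       ≡⟨ cong (_∸ suc p) (tetrahedral-closed p) ⟩
    suc p ^ 3 ∸ suc p                       ∎

proposition9 : (n : ℕ) → 2 ≤ n →
    HasExactly (λ A → InS n A × Idempotent A) ((n * suc n) / 2)
    × HasExactly (λ A → InS n A × Nilpotent A) (((n ^ 3) ∸ n) / 3 + 1)
proposition9 (suc p) _ =
  subst (HasExactly _) (idempotent-count p) (idempotents p) ,
  subst (HasExactly _) (nilpotent-count p) (nilpotents p)
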